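{- For all $n\geq 0$, $T_n\leq T'_n$, where $T_0=\bot$, $T_{n+1}=\{a,b,c\mid T_n\}$, $G_0=a$, $G_{k+1}=\{a,b\mid G_k\}$, and $T'_n=\mathrm{pinwheel}(G_{n+2},G_{n+2},G_{n+2})$.
   Context: Outcome poset $P_3=\{\bot,a,b,c,\top\}$ with $\bot<a,b,c<\top$, $a,b,c$ incomparable; each outcome is identified with an equivalence relation on terminals $\{1,2,3\}$: $\bot$ identity, $a$ identifies exactly $2,3$, $b$ exactly $1,3$, $c$ exactly $1,2$, $\top$ all. Game forms over $P_3$: atomic $[x]$ (written $x$) and composite $\{L\mid R\}$ with $L,R$ nonempty sets of game forms; atomic games have no options. $G^{(L)}$ is a left option of $G$ if $G$ is composite and $G$ itself if atomic; similarly $G^{(R)}$. Mutually recursively: $G\leq H$ iff every $G^{(L)}\lhd H$ and $G\lhd H^{(R)}$ for every $H^{(R)}$; $G\lhd H$ iff some $G^R\leq H$, or $G\leq H^L$ for some $H^L$, or both are atomic $[x],[y]$ with $x\leq y$. Pinwheel composition: define $p:P_3^3\to P_3$ as follows. For outcomes $x_1,x_2,x_3$ on terminal sets $\{(i,1),(i,2),(i,3)\}$, $i=1,2,3$, take the equivalence relation generated by each $x_i$ on the $i$-th terminal set together with $(1,1)\sim(2,2)$, $(1,2)\sim(3,1)$, $(2,1)\sim(3,2)$; its restriction to the new terminals $1:=(1,3)$, $2:=(2,3)$, $3:=(3,3)$ is $p(x_1,x_2,x_3)$. (E.g. $p(a,a,a)=\bot$, $p(a,a,b)=b$, $p(b,a,a)=c$.)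 For game forms, $\mathrm{pinwheel}(G_1,G_2,G_3)$ is the atomic game $p(x_1,x_2,x_3)$ if all $G_i=[x_i]$ are atomic, and otherwise the composite game whose left (resp. right) options are all $\mathrm{pinwheel}$ of the triples obtained by replacing exactly one $G_i$ by one of its left (resp. right) options. -}

module Defs where

open import Data.Bool using (Bool; true; false; _∨_; _∧_)
open import Data.Fin using (Fin; zero; suc)
open import Data.Fin.Properties using (_≟_)
open import Data.Product using (_×_; _,_)
open import Data.Sum using (_⊎_; inj₁; inj₂; [_,_])
open import Data.Empty using (⊥)
open import Data.Unit using (⊤; tt)
open import Data.Nat using (ℕ; zero; suc)
open import Data.List using (List; cartesianProduct)
open import Data.Bool.ListAction using (any)
open import Data.List using () renaming (allFin to allFinL)
open import Relation.Nullary.Decidable using (⌊_⌋)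

data P3 : Set where
  bot a b c top : P3

data _≤P_ : P3 → P3 → Set where
  bot≤ : ∀ {x} → bot ≤P x
  ≤top : ∀ {x} → x ≤P top
  a≤a  : a ≤P a
  b≤b  : b ≤P b
  c≤c  : c ≤P c

-- Outcomes as equivalence relations on terminals {1,2,3}
-- (represented as Fin 3 = {0,1,2}: terminal k is Fin index k-1)

eqF : Fin 3 → Fin 3 → Bool
eqF s t = ⌊ s ≟ t ⌋

pairIs : Fin 3 → Fin 3 → Fin 3 → Fin 3 → Bool
pairIs u v s t = (eqF s u ∧ eqF t v) ∨ (eqF s v ∧ eqF t u)

rel : P3 → Fin 3 → Fin 3 → Bool
rel bot s t = eqF s t
rel a   s t = eqF s t ∨ pairIs (suc zero) (suc (suc zero)) s t
rel b   s t = eqF s t ∨ pairIs zero (suc (suc zero)) s t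
rel c   s t = eqF s t ∨ pairIs zero (suc zero) s t
rel top s t = true

-- terminal (i , t) = the t-th terminal of the i-th component
Term : Set
Term = Fin 3 × Fin 3

allTerm : List Term
allTerm = cartesianProduct (allFinL 3) (allFinL 3)

eqT : Term → Term → Bool
eqT (i , s) (j , t) = eqF i j ∧ eqF s t

glue1 : Term → Term → Term → Term → Bool
glue1 p q u v = (eqT u p ∧ eqT v q) ∨ (eqT u q ∧ eqT v p)

-- (1,1)~(2,2), (1,2)~(3,1), (2,1)~(3,2)   (1-based, as in the paper)
glue : Term → Term → Bool
glue u v = glue1 (zero , zero) (suc zero , suc zero) u v
         ∨ glue1 (zero , suc zero) (suc (suc zero) , zero) u v
         ∨ glue1 (suc zero , zero) (suc (suc zero) , suc zero) u v

comp3 : P3 → P3 → P3 → Fin 3 → P3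
comp3 x₁ x₂ x₃ zero = x₁
comp3 x₁ x₂ x₃ (suc zero) = x₂
comp3 x₁ x₂ x₃ (suc (suc zero)) = x₃

baseRel : P3 → P3 → P3 → Term → Term → Bool
baseRel x₁ x₂ x₃ (i , s) (j , t) =
  (eqF i j ∧ rel (comp3 x₁ x₂ x₃ i) s t) ∨ glue (i , s) (j , t)

stepRel : (Term → Term → Bool) → Term → Term → Bool
stepRel R u v = R u v ∨ any (λ w → R u w ∧ R w v) allTerm

iterate : ℕ → (Term → Term → Bool) → Term → Term → Bool
iterate zero    R = R
iterate (suc k) R = stepRel (iterate k R)

-- generated equivalence relation (base is reflexive and symmetric; 4
-- squarings give paths of length ≤ 16 ≥ 9 = number of terminals)
genRel : P3 → P3 → P3 → Term → Term → Bool
genRel x₁ x₂ x₃ = iterate 4 (baseRel x₁ x₂ x₃)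

fromPairs : Bool → Bool → Bool → P3   -- r12 r13 r23
fromPairs true  true  true  = top
fromPairs false false true  = a
fromPairs false true  false = b
fromPairs true  false false = c
fromPairs false false false = bot
fromPairs _     _     _     = top   -- impossible for equivalence relations

-- new terminals 1 := (1,3), 2 := (2,3), 3 := (3,3)
p : P3 → P3 → P3 → P3
p x₁ x₂ x₃ =
  fromPairs (R n1 n2) (R n1 n3) (R n2 n3)
  where
  R = genRel x₁ x₂ x₃
  n1 n2 n3 : Term
  n1 = (zero , suc (suc zero))
  n2 = (suc zero , suc (suc zero))
  n3 = (suc (suc zero) , suc (suc zero))

-- Game forms over P₃: atomic [x], or {L | R} with L, R nonempty sets of
-- game forms, given as families indexed by a set together with a
-- witness of nonemptiness of the index set.

data Game : Set₁ where
  atom : P3 → Game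
  comp : {I J : Set} → I → J → (I → Game) → (J → Game) → Game

LIdx : Game → Set
LIdx (atom x) = ⊤
LIdx (comp {I} {J} i j L R) = I

RIdx : Game → Set
RIdx (atom x) = ⊤
RIdx (comp {I} {J} i j L R) = J

lopt : (G : Game) → LIdx G → Game
lopt (atom x) _ = atom x
lopt (comp i j L R) k = L k

ropt : (G : Game) → RIdx G → Game
ropt (atom x) _ = atom x
ropt (comp i j L R) k = R k

infix 4 _≤G_ _◁G_

data _≤G_ : Game → Game → Set₁
data _◁G_ : Game → Game → Set₁

data _≤G_ where
  le : ∀ {G H} → ((k : LIdx G) → lopt G k ◁G H)
                → ((k : RIdx H) → G ◁G ropt H k) → G ≤G H

data _◁G_ where
  ◁R : ∀ {I J} {i : I} {j : J} {L : I → Game} {R : J → Game} {H}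
       (k : J) → R k ≤G H → comp i j L R ◁G H
  ◁L : ∀ {G I J} {i : I} {j : J} {L : I → Game} {R : J → Game}
       (k : I) → G ≤G L k → G ◁G comp i j L R
  ◁atom : ∀ {x y} → x ≤P y → atom x ◁G atom y

LOpt : Game → Set
LOpt (atom x) = ⊥
LOpt (comp {I} {J} i j L R) = I

ROpt : Game → Set
ROpt (atom x) = ⊥
ROpt (comp {I} {J} i j L R) = J

fam3 : {A B C : Set} → (A → Game) → (B → Game) → (C → Game) → A ⊎ (B ⊎ C) → Game
fam3 f g h = [ f , [ g , h ] ]

-- left options: replace exactly one Gᵢ by one of its left options
-- (index set LOpt G₁ ⊎ LOpt G₂ ⊎ LOpt G₃), similarly on the right.
pinwheel : Game → Game → Game → Game
pinwheel (atom x) (atom y) (atom z) = atom (p x y z)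
pinwheel G₁@(comp i₁ j₁ L₁ R₁) G₂ G₃ =
  comp {LOpt G₁ ⊎ (LOpt G₂ ⊎ LOpt G₃)} {ROpt G₁ ⊎ (ROpt G₂ ⊎ ROpt G₃)}
       (inj₁ i₁) (inj₁ j₁)
       (fam3 (λ k → pinwheel (L₁ k) G₂ G₃) (lo2 G₂) (lo3 G₂ G₃))
       (fam3 (λ k → pinwheel (R₁ k) G₂ G₃) (ro2 G₂) (ro3 G₂ G₃))
  where
  lo2 : (H : Game) → LOpt H → Game
  lo2 (comp _ _ L R) k = pinwheel G₁ (L k) G₃
  ro2 : (H : Game) → ROpt H → Game
  ro2 (comp _ _ L R) k = pinwheel G₁ (R k) G₃
  lo3 : (H K : Game) → LOpt K → Game
  lo3 H (comp _ _ L R) k = pinwheel G₁ G₂ (L k)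
  ro3 : (H K : Game) → ROpt K → Game
  ro3 H (comp _ _ L R) k = pinwheel G₁ G₂ (R k)
pinwheel (atom x) G₂@(comp i₂ j₂ L₂ R₂) G₃ =
  comp {⊥ ⊎ (LOpt G₂ ⊎ LOpt G₃)} {⊥ ⊎ (ROpt G₂ ⊎ ROpt G₃)}
       (inj₂ (inj₁ i₂)) (inj₂ (inj₁ j₂))
       (fam3 (λ ()) (λ k → pinwheel (atom x) (L₂ k) G₃) (lo3 G₃))
       (fam3 (λ ()) (λ k → pinwheel (atom x) (R₂ k) G₃) (ro3 G₃))
  where
  lo3 : (K : Game) → LOpt K → Game
  lo3 (comp _ _ L R) k = pinwheel (atom x) G₂ (L k)
  ro3 : (K : Game) → ROpt K → Game
  ro3 (comp _ _ L R) k = pinwheel (atom x) G₂ (R k)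
pinwheel (atom x) (atom y) (comp {I} {J} i₃ j₃ L₃ R₃) =
  comp {⊥ ⊎ (⊥ ⊎ I)} {⊥ ⊎ (⊥ ⊎ J)}
       (inj₂ (inj₂ i₃)) (inj₂ (inj₂ j₃))
       (fam3 (λ ()) (λ ()) (λ k → pinwheel (atom x) (atom y) (L₃ k)))
       (fam3 (λ ()) (λ ()) (λ k → pinwheel (atom x) (atom y) (R₃ k)))

abc : Fin 3 → Game
abc zero = atom a
abc (suc zero) = atom b
abc (suc (suc zero)) = atom c

T : ℕ → Game
T zero    = atom bot
T (suc n) = comp {Fin 3} {⊤} zero tt abc (λ _ → T n)

ab : Fin 2 → Game
ab zero = atom a
ab (suc zero) = atom b

Gm : ℕ → Game
Gm zero    = atom a
Gm (suc k) = comp {Fin 2} {⊤} zero tt ab (λ _ → Gm k)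

T′ : ℕ → Game
T′ n = pinwheel (Gm (suc (suc n))) (Gm (suc (suc n))) (Gm (suc (suc n)))

-- Left answers each left option a, b, c of T_{n+1} by moving one component of
-- the pinwheel to its option b.  What remains is at least a, b resp. c: Left
-- can always drive every G_m back to the atom a while Right's moves keep that
-- possibility, and p(a,b,a) = a, p(a,a,b) = b, p(b,a,a) = c.  The right option
-- T_n is answered by induction, for which the three components are allowed to
-- be any G_m with m ≥ n + 2 independently, since a Right move lowers just one.
module Submission where

open import Defs
open import Data.Nat using (ℕ; zero; suc; _+_; _≤_; s≤s)
open import Data.Nat.Properties using (≤-refl; m≤n⇒m≤1+n)
open import Data.Fin using (Fin; zero; suc)
open import Data.Unit using (tt)
open import Data.Sum using (inj₁; inj₂)

leftOption : (G : Game) → LOpt G → Game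
leftOption (comp _ _ L _) k = L k

rightOption : (G : Game) → ROpt G → Game
rightOption (comp _ _ _ R) k = R k

data PinwheelLeft : Game → Game → Game → Game → Set₁ where
  left₁ : ∀ {G₁ G₂ G₃} (k : LOpt G₁) → PinwheelLeft G₁ G₂ G₃ (pinwheel (leftOption G₁ k) G₂ G₃)
  left₂ : ∀ {G₁ G₂ G₃} (k : LOpt G₂) → PinwheelLeft G₁ G₂ G₃ (pinwheel G₁ (leftOption G₂ k) G₃)
  left₃ : ∀ {G₁ G₂ G₃} (k : LOpt G₃) → PinwheelLeft G₁ G₂ G₃ (pinwheel G₁ G₂ (leftOption G₃ k))

-- Right options in the sense of ropt, under which an atomic game is its own.
data PinwheelRight : Game → Game → Game → Game → Set₁ where
  right₁ : ∀ {G₁ G₂ G₃} (k : ROpt G₁) → PinwheelRight G₁ G₂ G₃ (pinwheel (rightOption G₁ k) G₂ G₃)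
  right₂ : ∀ {G₁ G₂ G₃} (k : ROpt G₂) → PinwheelRight G₁ G₂ G₃ (pinwheel G₁ (rightOption G₂ k) G₃)
  right₃ : ∀ {G₁ G₂ G₃} (k : ROpt G₃) → PinwheelRight G₁ G₂ G₃ (pinwheel G₁ G₂ (rightOption G₃ k))
  right-self : ∀ {x y z} → PinwheelRight (atom x) (atom y) (atom z) (atom (p x y z))

◁-pinwheel : ∀ {G₁ G₂ G₃ H X} → PinwheelLeft G₁ G₂ G₃ H → X ≤G H → X ◁G pinwheel G₁ G₂ G₃
◁-pinwheel {comp _ _ _ _}                                 (left₁ k) h = ◁L (inj₁ k) h
◁-pinwheel {comp _ _ _ _} {comp _ _ _ _}                  (left₂ k) h = ◁L (inj₂ (inj₁ k)) h
◁-pinwheel {atom _}       {comp _ _ _ _}                  (left₂ k) h = ◁L (inj₂ (inj₁ k)) h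
◁-pinwheel {comp _ _ _ _} {_}            {comp _ _ _ _}   (left₃ k) h = ◁L (inj₂ (inj₂ k)) h
◁-pinwheel {atom _}       {comp _ _ _ _} {comp _ _ _ _}   (left₃ k) h = ◁L (inj₂ (inj₂ k)) h
◁-pinwheel {atom _}       {atom _}       {comp _ _ _ _}   (left₃ k) h = ◁L (inj₂ (inj₂ k)) h

pinwheel-right : ∀ G₁ G₂ G₃ (k : RIdx (pinwheel G₁ G₂ G₃)) →
                 PinwheelRight G₁ G₂ G₃ (ropt (pinwheel G₁ G₂ G₃) k)
pinwheel-right (atom _)       (atom _)       (atom _)       tt                = right-self
pinwheel-right (comp _ _ _ _) _              _              (inj₁ k)          = right₁ k
pinwheel-right (comp _ _ _ _) (comp _ _ _ _) _              (inj₂ (inj₁ k))   = right₂ k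
pinwheel-right (comp _ _ _ _) _              (comp _ _ _ _) (inj₂ (inj₂ k))   = right₃ k
pinwheel-right (atom _)       (comp _ _ _ _) _              (inj₂ (inj₁ k))   = right₂ k
pinwheel-right (atom _)       (comp _ _ _ _) (comp _ _ _ _) (inj₂ (inj₂ k))   = right₃ k
pinwheel-right (atom _)       (atom _)       (comp _ _ _ _) (inj₂ (inj₂ k))   = right₃ k

bot≤G : ∀ H → atom bot ≤G H
bot◁G : ∀ H → atom bot ◁G H
bot≤G (atom _)           = le (λ _ → ◁atom bot≤) (λ _ → ◁atom bot≤)
bot≤G G@(comp _ _ _ R)   = le (λ _ → bot◁G G) (λ k → bot◁G (R k))
bot◁G (atom _)           = ◁atom bot≤
bot◁G (comp i _ L _)     = ◁L i (bot≤G (L i))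

data Anchored (y : P3) : Game → Set₁ where
  atomic    : Anchored y (atom y)
  composite : ∀ {I J} {i : I} {j : J} {L : I → Game} {R : J → Game}
              (k : I) → Anchored y (L k) → ((k : J) → Anchored y (R k)) →
              Anchored y (comp i j L R)

Gm-anchored : ∀ m → Anchored a (Gm m)
Gm-anchored zero    = atomic
Gm-anchored (suc m) = composite zero atomic (λ _ → Gm-anchored m)

module _ {x y₁ y₂ y₃ : P3} (x≤p : x ≤P p y₁ y₂ y₃) where

  atom≤pinwheel : ∀ {G₁ G₂ G₃} → Anchored y₁ G₁ → Anchored y₂ G₂ → Anchored y₃ G₃ →
                  atom x ≤G pinwheel G₁ G₂ G₃
  atom◁pinwheel : ∀ {G₁ G₂ G₃} → Anchored y₁ G₁ → Anchored y₂ G₂ → Anchored y₃ G₃ →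
                  atom x ◁G pinwheel G₁ G₂ G₃
  atom◁right    : ∀ {G₁ G₂ G₃ H} → Anchored y₁ G₁ → Anchored y₂ G₂ → Anchored y₃ G₃ →
                  PinwheelRight G₁ G₂ G₃ H → atom x ◁G H

  atom≤pinwheel {G₁} {G₂} {G₃} α β γ =
    le (λ _ → atom◁pinwheel α β γ) (λ k → atom◁right α β γ (pinwheel-right G₁ G₂ G₃ k))

  atom◁pinwheel atomic atomic atomic             = ◁atom x≤p
  atom◁pinwheel (composite k α _) β γ            = ◁-pinwheel (left₁ k) (atom≤pinwheel α β γ)
  atom◁pinwheel atomic (composite k β _) γ       = ◁-pinwheel (left₂ k) (atom≤pinwheel atomic β γ)
  atom◁pinwheel atomic atomic (composite k γ _)  = ◁-pinwheel (left₃ k) (atom≤pinwheel atomic atomic γ)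

  atom◁right (composite _ _ αᴿ) β γ (right₁ k) = atom◁pinwheel (αᴿ k) β γ
  atom◁right α (composite _ _ βᴿ) γ (right₂ k) = atom◁pinwheel α (βᴿ k) γ
  atom◁right α β (composite _ _ γᴿ) (right₃ k) = atom◁pinwheel α β (γᴿ k)
  atom◁right atomic atomic atomic right-self   = ◁atom x≤p

abc◁pinwheel : ∀ {m₁ m₂ m₃} (l : Fin 3) →
               abc l ◁G pinwheel (Gm (suc m₁)) (Gm (suc m₂)) (Gm (suc m₃))
abc◁pinwheel {m₁} {m₂} {m₃} = answer
  where
  G₁ G₂ G₃ : Game
  G₁ = Gm (suc m₁)
  G₂ = Gm (suc m₂)
  G₃ = Gm (suc m₃)
  answer : (l : Fin 3) → abc l ◁G pinwheel G₁ G₂ G₃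
  answer zero             = ◁-pinwheel {G₁} {G₂} {G₃} (left₂ (suc zero))
                              (atom≤pinwheel a≤a (Gm-anchored (suc m₁)) atomic (Gm-anchored (suc m₃)))
  answer (suc zero)       = ◁-pinwheel {G₁} {G₂} {G₃} (left₃ (suc zero))
                              (atom≤pinwheel b≤b (Gm-anchored (suc m₁)) (Gm-anchored (suc m₂)) atomic)
  answer (suc (suc zero)) = ◁-pinwheel {G₁} {G₂} {G₃} (left₁ (suc zero))
                              (atom≤pinwheel c≤c atomic (Gm-anchored (suc m₂)) (Gm-anchored (suc m₃)))

T≤pinwheel : ∀ n {m₁ m₂ m₃} → 2 + n ≤ m₁ → 2 + n ≤ m₂ → 2 + n ≤ m₃ →
             T n ≤G pinwheel (Gm m₁) (Gm m₂) (Gm m₃)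
T≤pinwheel zero    _ _ _ = bot≤G _
T≤pinwheel (suc n) {suc m₁} {suc m₂} {suc m₃} (s≤s h₁) (s≤s h₂) (s≤s h₃) =
  le abc◁pinwheel (λ k → answer (pinwheel-right (Gm (suc m₁)) (Gm (suc m₂)) (Gm (suc m₃)) k))
  where
  answer : ∀ {H} → PinwheelRight (Gm (suc m₁)) (Gm (suc m₂)) (Gm (suc m₃)) H → T (suc n) ◁G H
  answer (right₁ _) = ◁R tt (T≤pinwheel n h₁ (m≤n⇒m≤1+n h₂) (m≤n⇒m≤1+n h₃))
  answer (right₂ _) = ◁R tt (T≤pinwheel n (m≤n⇒m≤1+n h₁) h₂ (m≤n⇒m≤1+n h₃))
  answer (right₃ _) = ◁R tt (T≤pinwheel n (m≤n⇒m≤1+n h₁) (m≤n⇒m≤1+n h₂) h₃)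

lemma4p10 : (n : ℕ) → T n ≤G T′ n
lemma4p10 n = T≤pinwheel n ≤-refl ≤-refl ≤-refl
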